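{- If a finite graph $G$ has arboricity $t$, then $B'(G)\le 2tB(G)+t-1$. Moreover, when $t=1$ the inequality is almost sharp: there exist caterpillars $G$ with $B'(G)=2B(G)-1$.
   Context: The arboricity of $G$ is the minimum number of forests whose edge sets partition $E(G)$. A caterpillar is a tree in which the subgraph obtained by deleting all leaves is a path. The bandwidth $B(G)$ is the minimum, over all assignments $g$ of distinct integers to the vertices of $G$, of $\max_{uv\in E(G)}|g(u)-g(v)|$. An edge-numbering of $G$ is an assignment $f$ of distinct integers to the edges; $B'(f)$ is the maximum of $|f(e)-f(e')|$ over pairs of distinct incident edges $e,e'$. The edge-bandwidth $B'(G)$ is the minimum of $B'(f)$ over all edge-numberings $f$ of $G$. -}

module Defs where

open import Data.Nat using (ℕ; zero; suc; _+_; _≤_)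
open import Data.Fin using (Fin; toℕ; fromℕ) renaming (zero to fzero)
open import Data.Integer using (ℤ; _-_; ∣_∣)
open import Data.Product using (Σ; ∃; _×_; _,_)
open import Data.Sum using (_⊎_)
open import Function.Definitions using (Injective)
open import Relation.Binary.PropositionalEquality using (_≡_; _≢_)
open import Relation.Nullary using (¬_)

record Graph : Set where
  field
    n : ℕ
    m : ℕ
    src : Fin m → Fin n
    tgt : Fin m → Fin n
    loopless : ∀ e → src e ≢ tgt e
    simple : ∀ e e' → ((src e ≡ src e' × tgt e ≡ tgt e') ⊎ (src e ≡ tgt e' × tgt e ≡ src e')) → e ≡ e'
open Graph public

Joins : (G : Graph) → Fin (m G) → Fin (n G) → Fin (n G) → Set
Joins G e u v = (src G e ≡ u × tgt G e ≡ v) ⊎ (src G e ≡ v × tgt G e ≡ u)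

AdjIn : (G : Graph) → (Fin (m G) → Set) → Fin (n G) → Fin (n G) → Set
AdjIn G P u v = Σ (Fin (m G)) λ e → P e × Joins G e u v

Adj : (G : Graph) → Fin (n G) → Fin (n G) → Set
Adj G u v = Σ (Fin (m G)) λ e → Joins G e u v

IncV : (G : Graph) → Fin (m G) → Fin (n G) → Set
IncV G e v = src G e ≡ v ⊎ tgt G e ≡ v

HasCycle : (G : Graph) → (Fin (m G) → Set) → Set
HasCycle G P = Σ ℕ λ k → Σ (Fin (3 + k) → Fin (n G)) λ c →
  Injective _≡_ _≡_ c ×
  (∀ i j → toℕ j ≡ suc (toℕ i) → AdjIn G P (c i) (c j)) ×
  AdjIn G P (c (fromℕ (2 + k))) (c fzero)

IsForest : (G : Graph) → (Fin (m G) → Set) → Set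
IsForest G P = ¬ HasCycle G P

ForestPartition : (G : Graph) → (t : ℕ) → Set
ForestPartition G t = Σ (Fin (m G) → Fin t) λ c → ∀ (i : Fin t) → IsForest G (λ e → c e ≡ i)

IsArboricity : Graph → ℕ → Set
IsArboricity G t = ForestPartition G t × (∀ s → ForestPartition G s → t ≤ s)

VertexNumberingBound : (G : Graph) → (Fin (n G) → ℤ) → ℕ → Set
VertexNumberingBound G g k = ∀ e → ∣ g (src G e) - g (tgt G e) ∣ ≤ k

IsBandwidth : Graph → ℕ → Set
IsBandwidth G b =
  (Σ (Fin (n G) → ℤ) λ g → Injective _≡_ _≡_ g × VertexNumberingBound G g b) ×
  (∀ (g : Fin (n G) → ℤ) → Injective _≡_ _≡_ g → ∀ k → VertexNumberingBound G g k → b ≤ k)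

IncidentEdges : (G : Graph) → Fin (m G) → Fin (m G) → Set
IncidentEdges G e e' = e ≢ e' × Σ (Fin (n G)) λ v → IncV G e v × IncV G e' v

EdgeNumberingBound : (G : Graph) → (Fin (m G) → ℤ) → ℕ → Set
EdgeNumberingBound G f k = ∀ e e' → IncidentEdges G e e' → ∣ f e - f e' ∣ ≤ k

IsEdgeBandwidth : Graph → ℕ → Set
IsEdgeBandwidth G b =
  (Σ (Fin (m G) → ℤ) λ f → Injective _≡_ _≡_ f × EdgeNumberingBound G f b) ×
  (∀ (f : Fin (m G) → ℤ) → Injective _≡_ _≡_ f → ∀ k → EdgeNumberingBound G f k → b ≤ k)

Connected : Graph → Set
Connected G = ∀ u v → Σ ℕ λ k → Σ (Fin (suc k) → Fin (n G)) λ w →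
  w fzero ≡ u × w (fromℕ k) ≡ v × (∀ i j → toℕ j ≡ suc (toℕ i) → Adj G (w i) (w j))

IsTree : Graph → Set
IsTree G = 1 ≤ n G × Connected G × IsForest G (λ _ → Data.Unit.⊤)
  where import Data.Unit

IsLeaf : (G : Graph) → Fin (n G) → Set
IsLeaf G v = Σ (Fin (m G)) λ e → IncV G e v × (∀ e' → IncV G e' v → e' ≡ e)

Consecutive : ∀ {k} → Fin k → Fin k → Set
Consecutive i j = toℕ j ≡ suc (toℕ i) ⊎ toℕ i ≡ suc (toℕ j)

-- the subgraph induced on the non-leaves (G minus all leaves) is a path:
-- its vertices can be listed without repetition as w 0, …, w (k-1) so that two
-- of them are adjacent exactly when consecutive in the list.
LeafDeletedIsPath : Graph → Set
LeafDeletedIsPath G = Σ ℕ λ k → Σ (Fin k → Fin (n G)) λ w →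
  Injective _≡_ _≡_ w ×
  (∀ i → ¬ IsLeaf G (w i)) ×
  (∀ v → ¬ IsLeaf G v → Σ (Fin k) λ i → w i ≡ v) ×
  (∀ i j → (Adj G (w i) (w j) → Consecutive i j) × (Consecutive i j → Adj G (w i) (w j)))

IsCaterpillar : Graph → Set
IsCaterpillar G = IsTree G × LeafDeletedIsPath G

module Submission where

-- Each forest of the partition has an orientation in which every vertex is the head of at most
-- one edge: a forest with an edge has a pendant edge (otherwise a non-backtracking walk would close
-- up into a cycle), which we orient towards its leaf before recursing on the remaining edges.
-- For an optimal vertex numbering g, the label t · g (head e) + colour e of an edge e is then
-- injective, and the heads of two incident edges are at g-distance at most 2B(G), so their labels
-- differ by at most 2tB(G) + t - 1.
-- The star K_{1,2b} shows sharpness: its 2b edges are pairwise incident, which forces B' = 2b - 1,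
-- while all 2b + 1 vertex labels lie within B of the label of the centre, which forces B = b.

open import Defs
open import Data.Nat using (ℕ; _+_; _*_; _∸_; _≤_)
open import Data.Product using (Σ; _×_)

open import Data.Empty using (⊥; ⊥-elim)
open import Data.Fin as Fin using (Fin; toℕ; fromℕ; fromℕ<; punchIn) renaming (zero to fzero; suc to fsuc)
import Data.Fin.Properties as Fin
open import Data.Fin.Subset as Subset using (Subset; _∈_)
open import Data.Fin.Subset.Properties using (_∈?_; ∈⊤; x∈p∧x≢y⇒x∈p-y; x∈p⇒∣p-x∣<∣p∣)
open import Data.Integer as ℤ using (ℤ; +_; ∣_∣; _⊖_)
import Data.Integer.Properties as ℤ
open import Algebra.Properties.AbelianGroup ℤ.+-0-abelianGroup using (∙-cancelˡ)
open import Data.Integer.Tactic.RingSolver using (solve-∀)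
open import Data.List using (allFin)
open import Data.List.Extrema ℤ.≤-totalOrder using (argmin; f[argmin]≤f[xs])
open import Data.List.Membership.Propositional.Properties using (∈-allFin)
import Data.List.Relation.Unary.All as All
open import Data.Nat using (zero; suc; _<_; _⊔_; z≤n; s≤s)
open import Data.Nat.Induction using (<-wellFounded)
import Data.Nat.Properties as ℕ
import Data.Nat.Tactic.RingSolver as ℕ-Solver
open import Data.Product using (_,_; proj₁; proj₂)
open import Data.Sum using (_⊎_; inj₁; inj₂; [_,_]′)
open import Function using (_∘_; case_of_)
open import Function.Definitions using (Injective)
open import Induction.WellFounded using (Acc; acc)
open import Relation.Binary.Definitions using (tri<; tri≈; tri>)
open import Relation.Binary.PropositionalEquality
open import Relation.Nullary using (¬_; Dec; yes; no; ¬?)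
open import Relation.Nullary.Decidable using (_×-dec_; _→-dec_; decidable-stable)
open import Relation.Unary using (Decidable)

module _ (G : Graph) where
  private
    V = Fin (n G)
    E = Fin (m G)

  joins⇒incidentʳ : ∀ {e u v} → Joins G e u v → IncV G e v
  joins⇒incidentʳ (inj₁ (_ , q)) = inj₂ q
  joins⇒incidentʳ (inj₂ (p , _)) = inj₁ p

  joins⇒≢ : ∀ {e u v} → Joins G e u v → u ≢ v
  joins⇒≢ {e} (inj₁ (p , q)) refl = loopless G e (trans p (sym q))
  joins⇒≢ {e} (inj₂ (p , q)) refl = loopless G e (trans p (sym q))

  joins-sym : ∀ {e u v} → Joins G e u v → Joins G e v u
  joins-sym (inj₁ j) = inj₂ j
  joins-sym (inj₂ j) = inj₁ j

  joins-unique : ∀ {e e' u v} → Joins G e u v → Joins G e' u v → e ≡ e'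
  joins-unique {e} {e'} (inj₁ (p , q)) (inj₁ (p' , q')) = simple G e e' (inj₁ (trans p (sym p') , trans q (sym q')))
  joins-unique {e} {e'} (inj₁ (p , q)) (inj₂ (p' , q')) = simple G e e' (inj₂ (trans p (sym q') , trans q (sym p')))
  joins-unique {e} {e'} (inj₂ (p , q)) (inj₁ (p' , q')) = simple G e e' (inj₂ (trans p (sym q') , trans q (sym p')))
  joins-unique {e} {e'} (inj₂ (p , q)) (inj₂ (p' , q')) = simple G e e' (inj₁ (trans p (sym p') , trans q (sym q')))

  other : E → V → V
  other e v with src G e Fin.≟ v
  ... | yes _ = tgt G e
  ... | no _ = src G e

  joins-other : ∀ {e v} → IncV G e v → Joins G e v (other e v)
  joins-other {e} {v} e∋v with src G e Fin.≟ v | e∋v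
  ... | yes p | _ = inj₁ (p , refl)
  ... | no ¬p | inj₁ p = ⊥-elim (¬p p)
  ... | no _ | inj₂ q = inj₂ (refl , q)

  incident? : ∀ e v → Dec (IncV G e v)
  incident? e v with src G e Fin.≟ v | tgt G e Fin.≟ v
  ... | yes p | _ = yes (inj₁ p)
  ... | no _ | yes q = yes (inj₂ q)
  ... | no ¬p | no ¬q = no λ { (inj₁ p) → ¬p p ; (inj₂ q) → ¬q q }

  hasCycle-mono : ∀ {P Q : E → Set} → (∀ {e} → P e → Q e) → HasCycle G P → HasCycle G Q
  hasCycle-mono {P} {Q} P⊆Q (k , c , c-inj , steps , closing) =
    k , c , c-inj , (λ i j next → weaken (steps i j next)) , weaken closing
    where
      weaken : ∀ {u v} → AdjIn G P u v → AdjIn G Q u v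
      weaken (e , pe , joins) = e , P⊆Q pe , joins

-- Pendant edges and orientations of forests

InjectiveBelow : {A : Set} → (ℕ → A) → ℕ → Set
InjectiveBelow w j = ∀ {a b} → a < b → b < j → w a ≢ w b

module _ {k : ℕ} (w : ℕ → Fin k) where

  private
    RepeatsAt : ℕ → Set
    RepeatsAt j = Σ ℕ λ i → i < j × w i ≡ w j

    Repetition : Set
    Repetition = Σ ℕ λ j → RepeatsAt j × InjectiveBelow w j

    repetition-or-injective : ∀ j → Repetition ⊎ InjectiveBelow w (suc j)
    repetition-or-injective zero = inj₂ λ { {b = zero} () _ ; {b = suc _} _ (s≤s ()) }
    repetition-or-injective (suc j) with repetition-or-injective j
    ... | inj₁ r = inj₁ r
    ... | inj₂ w-inj with ℕ.anyUpTo? (λ i → w i Fin.≟ w (suc j)) (suc j)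
    ...   | yes r = inj₁ (suc j , r , w-inj)
    ...   | no ¬r = inj₂ extend
      where
        extend : InjectiveBelow w (2 + j)
        extend {a} {b} a<b b<2+j with ℕ.m≤n⇒m<n∨m≡n (ℕ.≤-pred b<2+j)
        ... | inj₁ b<1+j = w-inj a<b b<1+j
        ... | inj₂ refl = λ eq → ¬r (a , a<b , eq)

    injectiveBelow⇒injective : ∀ {j} → InjectiveBelow w j → Injective _≡_ _≡_ (λ (i : Fin j) → w (toℕ i))
    injectiveBelow⇒injective {j} w-inj {a} {b} eq with ℕ.<-cmp (toℕ a) (toℕ b)
    ... | tri< a<b _ _ = ⊥-elim (w-inj a<b (Fin.toℕ<n b) eq)
    ... | tri≈ _ a≡b _ = Fin.toℕ-injective a≡b
    ... | tri> _ _ b<a = ⊥-elim (w-inj b<a (Fin.toℕ<n a) (sym eq))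

    <⇒gap : ∀ {i j} → i < j → Σ ℕ λ d → suc d + i ≡ j
    <⇒gap {i} i<j with ℕ.m≤n⇒∃[o]m+o≡n i<j
    ... | d , eq = d , trans (cong suc (ℕ.+-comm d i)) eq

  firstRepetition : Σ ℕ λ i → Σ ℕ λ d → w (suc d + i) ≡ w i × InjectiveBelow w (suc d + i)
  firstRepetition with repetition-or-injective k
  ... | inj₂ w-inj = ⊥-elim (ℕ.1+n≰n (Fin.injective⇒≤ (injectiveBelow⇒injective w-inj)))
  ... | inj₁ (j , (i , i<j , repeat) , w-inj) with <⇒gap i<j
  ...   | d , refl = i , d , sym repeat , w-inj

record NonBacktrackingWalk (G : Graph) (P : Fin (m G) → Set) : Set where
  field
    vertex : ℕ → Fin (n G)
    edge : ℕ → Fin (m G)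
    edge∈P : ∀ j → P (edge j)
    edge-joins : ∀ j → Joins G (edge j) (vertex j) (vertex (suc j))
    no-backtracking : ∀ j → edge (suc j) ≢ edge j

module _ {G : Graph} {P : Fin (m G) → Set} (W : NonBacktrackingWalk G P) where
  open NonBacktrackingWalk W

  private
    -- A closed segment with one edge is a loop and one with two edges backtracks; longer ones are cycles.
    closedSegment⇒cycle : ∀ i d → vertex (suc d + i) ≡ vertex i → InjectiveBelow vertex (suc d + i) → HasCycle G P
    closedSegment⇒cycle i zero closed _ = ⊥-elim (joins⇒≢ G (edge-joins i) (sym closed))
    closedSegment⇒cycle i (suc zero) closed _ =
      ⊥-elim (no-backtracking i (joins-unique G (subst (Joins G (edge (suc i)) (vertex (suc i))) closed (edge-joins (suc i)))
                                              (joins-sym G (edge-joins i))))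
    closedSegment⇒cycle i (suc (suc k)) closed injective = k , c , c-inj , steps , closing
      where
        c : Fin (3 + k) → Fin (n G)
        c l = vertex (toℕ l + i)
        c-inj : Injective _≡_ _≡_ c
        c-inj {l} {l'} eq with ℕ.<-cmp (toℕ l) (toℕ l')
        ... | tri< l<l' _ _ = ⊥-elim (injective (ℕ.+-monoˡ-< i l<l') (ℕ.+-monoˡ-< i (Fin.toℕ<n l')) eq)
        ... | tri≈ _ l≡l' _ = Fin.toℕ-injective l≡l'
        ... | tri> _ _ l'<l = ⊥-elim (injective (ℕ.+-monoˡ-< i l'<l) (ℕ.+-monoˡ-< i (Fin.toℕ<n l)) (sym eq))
        steps : ∀ l l' → toℕ l' ≡ suc (toℕ l) → AdjIn G P (c l) (c l')
        steps l l' next = edge (toℕ l + i) , edge∈P _ , subst (λ x → Joins G _ (c l) (vertex (x + i))) (sym next) (edge-joins _)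
        closing : AdjIn G P (c (fromℕ (2 + k))) (c fzero)
        closing = edge (2 + k + i) , edge∈P _ ,
          subst₂ (Joins G _) (cong (λ x → vertex (x + i)) (sym (Fin.toℕ-fromℕ (2 + k)))) closed (edge-joins _)

  nonBacktrackingWalk⇒cycle : HasCycle G P
  nonBacktrackingWalk⇒cycle with firstRepetition vertex
  ... | i , d , closed , injective = closedSegment⇒cycle i d closed injective

Pendant : (G : Graph) → (Fin (m G) → Set) → Fin (n G) → Fin (m G) → Set
Pendant G P v e = P e × IncV G e v × (∀ e' → P e' → IncV G e' v → e' ≡ e)

module _ (G : Graph) {P : Fin (m G) → Set} (P? : Decidable P) where
  private
    V = Fin (n G)
    E = Fin (m G)

    pendant? : ∀ v e → Dec (Pendant G P v e)
    pendant? v e = P? e ×-dec incident? G e v ×-dec Fin.all? (λ e' → P? e' →-dec (incident? G e' v →-dec (e' Fin.≟ e)))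

    pendant-or-branch : ∀ {v e} → P e → IncV G e v → Pendant G P v e ⊎ Σ E λ e' → P e' × IncV G e' v × e' ≢ e
    pendant-or-branch {v} {e} pe e∋v with Fin.any? (λ e' → P? e' ×-dec incident? G e' v ×-dec ¬? (e' Fin.≟ e))
    ... | yes branch = inj₂ branch
    ... | no ¬branch = inj₁ (pe , e∋v , λ e' pe' e'∋v → decidable-stable (e' Fin.≟ e) λ e'≢e → ¬branch (e' , pe' , e'∋v , e'≢e))

    record Dart : Set where
      constructor dart
      field
        tail : V
        edge : E
        edge∈P : P edge
        edge∋tail : IncV G edge tail
    open Dart

    module _ (no-pendant : ∀ v e → ¬ Pendant G P v e) where

      advance : (d : Dart) → Σ Dart λ d' → Joins G (edge d) (tail d) (tail d') × edge d' ≢ edge d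
      advance (dart v e pe e∋v) with pendant-or-branch pe (joins⇒incidentʳ G (joins-other G e∋v))
      ... | inj₁ pendant = ⊥-elim (no-pendant _ _ pendant)
      ... | inj₂ (e' , pe' , e'∋u , e'≢e) = dart _ e' pe' e'∋u , joins-other G e∋v , e'≢e

      walk : Dart → ℕ → Dart
      walk d zero = d
      walk d (suc j) = proj₁ (advance (walk d j))

      noPendant⇒walk : Dart → NonBacktrackingWalk G P
      noPendant⇒walk d = record
        { vertex = tail ∘ walk d
        ; edge = edge ∘ walk d
        ; edge∈P = edge∈P ∘ walk d
        ; edge-joins = proj₁ ∘ proj₂ ∘ advance ∘ walk d
        ; no-backtracking = proj₂ ∘ proj₂ ∘ advance ∘ walk d
        }

  forest⇒pendant : IsForest G P → ∀ {e} → P e → Σ V λ v → Σ E λ e₀ → Pendant G P v e₀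
  forest⇒pendant acyclic {e} pe with Fin.any? (λ v → Fin.any? (pendant? v))
  ... | yes pendant = pendant
  ... | no ¬pendant = ⊥-elim (acyclic (nonBacktrackingWalk⇒cycle
                        (noPendant⇒walk (λ v e₀ p → ¬pendant (v , e₀ , p)) (dart (src G e) e pe (inj₁ refl)))))

record Orientation (G : Graph) (P : Fin (m G) → Set) : Set where
  field
    head : Fin (m G) → Fin (n G)
    head-incident : ∀ e → IncV G e (head e)
    head-injective : ∀ {e e'} → P e → P e' → head e ≡ head e' → e ≡ e'

module _ {G : Graph} where
  private
    V = Fin (n G)
    E = Fin (m G)

  orientation-mono : ∀ {P Q : E → Set} → (∀ {e} → Q e → P e) → Orientation G P → Orientation G Q
  orientation-mono Q⊆P O = record { Orientation O ; head-injective = λ q q' → head-injective (Q⊆P q) (Q⊆P q') }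
    where open Orientation O

  orientation-extend : ∀ {P v e₀} → Pendant G P v e₀ → Orientation G (λ e → P e × e ≢ e₀) → Orientation G P
  orientation-extend {P} {v} {e₀} (_ , e₀∋v , only-e₀) O = record
    { head = head' ; head-incident = head'-incident ; head-injective = head'-injective }
    where
      open Orientation O
      head' : E → V
      head' e with e Fin.≟ e₀
      ... | yes _ = v
      ... | no _ = head e
      head'-incident : ∀ e → IncV G e (head' e)
      head'-incident e with e Fin.≟ e₀
      ... | yes refl = e₀∋v
      ... | no _ = head-incident e
      head'-injective : ∀ {e e'} → P e → P e' → head' e ≡ head' e' → e ≡ e'
      head'-injective {e} {e'} pe pe' same with e Fin.≟ e₀ | e' Fin.≟ e₀
      ... | yes refl | yes refl = refl
      ... | yes refl | no e'≢e₀ = ⊥-elim (e'≢e₀ (only-e₀ e' pe' (subst (IncV G e') (sym same) (head-incident e'))))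
      ... | no e≢e₀ | yes refl = ⊥-elim (e≢e₀ (only-e₀ e pe (subst (IncV G e) same (head-incident e))))
      ... | no e≢e₀ | no e'≢e₀ = head-injective (pe , e≢e₀) (pe' , e'≢e₀) same

module _ {G : Graph} {P : Fin (m G) → Set} (P? : Decidable P) (acyclic : IsForest G P) where

  private
    -- The subset s only supplies the measure ∣ s ∣ for the recursion.
    orientation-∩ : (s : Subset (m G)) → Acc _<_ Subset.∣ s ∣ → Orientation G (λ e → e ∈ s × P e)
    orientation-∩ s (acc smaller) with Fin.any? (λ e → (e ∈? s) ×-dec P? e)
    ... | no empty = record
      { head = src G ; head-incident = λ _ → inj₁ refl ; head-injective = λ p _ _ → ⊥-elim (empty (_ , p)) }
    ... | yes (_ , q) with forest⇒pendant G (λ e → (e ∈? s) ×-dec P? e) (acyclic ∘ hasCycle-mono G proj₂) q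
    ...   | v , e₀ , pendant@((e₀∈s , _) , _) =
      orientation-extend pendant (orientation-mono (λ ((e∈s , pe) , e≢e₀) → x∈p∧x≢y⇒x∈p-y e∈s e≢e₀ , pe)
                                   (orientation-∩ (s Subset.- e₀) (smaller (x∈p⇒∣p-x∣<∣p∣ e₀∈s))))

  forest⇒orientation : Orientation G P
  forest⇒orientation = orientation-mono (λ pe → ∈⊤ , pe) (orientation-∩ Subset.⊤ (<-wellFounded _))

-- Integer labels

∣i-i∣≤n : ∀ i {b} → ∣ i ℤ.- i ∣ ≤ b
∣i-i∣≤n i = ℕ.≤-trans (ℕ.≤-reflexive (cong ∣_∣ (ℤ.+-inverseʳ i))) z≤n

∣i-k∣≤∣i-j∣+∣j-k∣ : ∀ i j k → ∣ i ℤ.- k ∣ ≤ ∣ i ℤ.- j ∣ + ∣ j ℤ.- k ∣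
∣i-k∣≤∣i-j∣+∣j-k∣ i j k = begin
  ∣ i ℤ.- k ∣                   ≡⟨ cong ∣_∣ (split i j k) ⟩
  ∣ (i ℤ.- j) ℤ.+ (j ℤ.- k) ∣   ≤⟨ ℤ.∣i+j∣≤∣i∣+∣j∣ (i ℤ.- j) (j ℤ.- k) ⟩
  ∣ i ℤ.- j ∣ + ∣ j ℤ.- k ∣     ∎
  where
    open ℕ.≤-Reasoning
    split : ∀ i j k → i ℤ.- k ≡ (i ℤ.- j) ℤ.+ (j ℤ.- k)
    split = solve-∀

∣m⊖n∣≤o : ∀ {m n o} → m ≤ n + o → n ≤ m + o → ∣ m ⊖ n ∣ ≤ o
∣m⊖n∣≤o {m} {n} m≤n+o n≤m+o with ℕ.≤-total m n
... | inj₁ m≤n = ℕ.≤-trans (ℕ.≤-reflexive (ℤ.∣⊖∣-≤ m≤n)) (ℕ.m≤n+o⇒m∸n≤o n m n≤m+o)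
... | inj₂ n≤m = ℕ.≤-trans (ℕ.≤-reflexive (trans (ℤ.∣m⊖n∣≡∣n⊖m∣ m n) (ℤ.∣⊖∣-≤ n≤m))) (ℕ.m≤n+o⇒m∸n≤o m n m≤n+o)

∣i-j∣≤n∸1 : ∀ {t} (i j : Fin t) → ∣ + toℕ i ℤ.- + toℕ j ∣ ≤ t ∸ 1
∣i-j∣≤n∸1 {t} i j = begin
  ∣ + toℕ i ℤ.- + toℕ j ∣   ≡⟨ cong ∣_∣ (ℤ.[+m]-[+n]≡m⊖n (toℕ i) (toℕ j)) ⟩
  ∣ toℕ i ⊖ toℕ j ∣         ≤⟨ ℤ.∣m⊝n∣≤m⊔n (toℕ i) (toℕ j) ⟩
  toℕ i ⊔ toℕ j             ≤⟨ ℕ.<⇒≤pred (ℕ.⊔-lub (Fin.toℕ<n i) (Fin.toℕ<n j)) ⟩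
  t ∸ 1                     ∎
  where open ℕ.≤-Reasoning

injective∧spread≤s⇒n≤1+s : ∀ {N s} (f : Fin N → ℤ) → Injective _≡_ _≡_ f → (∀ i j → ∣ f i ℤ.- f j ∣ ≤ s) → N ≤ suc s
injective∧spread≤s⇒n≤1+s {zero} _ _ _ = z≤n
injective∧spread≤s⇒n≤1+s {suc N} {s} f f-inj spread = Fin.injective⇒≤ offset-inj
  where
    i₀ : Fin (suc N)
    i₀ = argmin f fzero (allFin (suc N))
    i₀-minimal : ∀ i → f i₀ ℤ.≤ f i
    i₀-minimal i = All.lookup (f[argmin]≤f[xs] {f = f} fzero (allFin (suc N))) (∈-allFin i)
    offset : Fin (suc N) → Fin (suc s)
    offset i = fromℕ< (s≤s (spread i₀ i))
    f≡f[i₀]+offset : ∀ i → f i ≡ f i₀ ℤ.+ + toℕ (offset i)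
    f≡f[i₀]+offset i = begin
      f i                             ≡⟨ shift (f i) (f i₀) ⟩
      f i₀ ℤ.+ (f i ℤ.- f i₀)         ≡⟨ cong (λ d → f i₀ ℤ.+ d) (ℤ.∣-∣-≤ (i₀-minimal i)) ⟨
      f i₀ ℤ.+ + ∣ f i₀ ℤ.- f i ∣     ≡⟨ cong (λ d → f i₀ ℤ.+ + d) (Fin.toℕ-fromℕ< _) ⟨
      f i₀ ℤ.+ + toℕ (offset i)       ∎
      where
        open ≡-Reasoning
        shift : ∀ x y → x ≡ y ℤ.+ (x ℤ.- y)
        shift = solve-∀
    offset-inj : Injective _≡_ _≡_ offset
    offset-inj {i} {j} eq = f-inj (begin
      f i                          ≡⟨ f≡f[i₀]+offset i ⟩
      f i₀ ℤ.+ + toℕ (offset i)    ≡⟨ cong (λ o → f i₀ ℤ.+ + toℕ o) eq ⟩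
      f i₀ ℤ.+ + toℕ (offset j)    ≡⟨ f≡f[i₀]+offset j ⟨
      f j                          ∎)
      where open ≡-Reasoning

module _ (t : ℕ) where

  radix-< : ∀ {a a' x x'} → x < t → a ℤ.< a' → + t ℤ.* a ℤ.+ + x ℤ.< + t ℤ.* a' ℤ.+ + x'
  radix-< {a} {a'} {x} {x'} x<t a<a' = begin-strict
    + t ℤ.* a ℤ.+ + x     <⟨ ℤ.+-monoʳ-< (+ t ℤ.* a) (ℤ.+<+ x<t) ⟩
    + t ℤ.* a ℤ.+ + t     ≡⟨ factor (+ t) a ⟩
    + t ℤ.* ℤ.suc a       ≤⟨ ℤ.*-monoˡ-≤-nonNeg (+ t) (ℤ.i<j⇒suc[i]≤j a<a') ⟩
    + t ℤ.* a'            ≤⟨ ℤ.i≤i+j (+ t ℤ.* a') (+ x') ⟩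
    + t ℤ.* a' ℤ.+ + x'   ∎
    where
      open ℤ.≤-Reasoning
      factor : ∀ t a → t ℤ.* a ℤ.+ t ≡ t ℤ.* (ℤ.1ℤ ℤ.+ a)
      factor = solve-∀

  radix-injective : ∀ {a a' x x'} → x < t → x' < t → + t ℤ.* a ℤ.+ + x ≡ + t ℤ.* a' ℤ.+ + x' → a ≡ a' × x ≡ x'
  radix-injective {a} {a'} {x} {x'} x<t x'<t eq with ℤ.<-cmp a a'
  ... | tri< a<a' _ _ = ⊥-elim (ℤ.<⇒≢ (radix-< x<t a<a') eq)
  ... | tri> _ _ a'<a = ⊥-elim (ℤ.<⇒≢ (radix-< x'<t a'<a) (sym eq))
  ... | tri≈ _ refl _ = refl , ℤ.+-injective (∙-cancelˡ (+ t ℤ.* a) (+ x) (+ x') eq)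

  radix-distance : ∀ a a' x x' →
    ∣ (+ t ℤ.* a ℤ.+ + x) ℤ.- (+ t ℤ.* a' ℤ.+ + x') ∣ ≤ t * ∣ a ℤ.- a' ∣ + ∣ + x ℤ.- + x' ∣
  radix-distance a a' x x' = begin
    ∣ (+ t ℤ.* a ℤ.+ + x) ℤ.- (+ t ℤ.* a' ℤ.+ + x') ∣     ≡⟨ cong ∣_∣ (regroup (+ t) a a' (+ x) (+ x')) ⟩
    ∣ + t ℤ.* (a ℤ.- a') ℤ.+ (+ x ℤ.- + x') ∣             ≤⟨ ℤ.∣i+j∣≤∣i∣+∣j∣ (+ t ℤ.* (a ℤ.- a')) (+ x ℤ.- + x') ⟩
    ∣ + t ℤ.* (a ℤ.- a') ∣ + ∣ + x ℤ.- + x' ∣             ≡⟨ cong (_+ ∣ + x ℤ.- + x' ∣) (ℤ.abs-* (+ t) (a ℤ.- a')) ⟩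
    t * ∣ a ℤ.- a' ∣ + ∣ + x ℤ.- + x' ∣                   ∎
    where
      open ℕ.≤-Reasoning
      regroup : ∀ t a a' x x' → (t ℤ.* a ℤ.+ x) ℤ.- (t ℤ.* a' ℤ.+ x') ≡ t ℤ.* (a ℤ.- a') ℤ.+ (x ℤ.- x')
      regroup = solve-∀

-- Edge numberings from forest partitions

incident⇒close : ∀ (G : Graph) {g b e u v} → VertexNumberingBound G g b → IncV G e u → IncV G e v → ∣ g u ℤ.- g v ∣ ≤ b
incident⇒close G {g} bound (inj₁ refl) (inj₁ refl) = ∣i-i∣≤n (g _)
incident⇒close G {g} bound (inj₂ refl) (inj₂ refl) = ∣i-i∣≤n (g _)
incident⇒close G {e = e} bound (inj₁ refl) (inj₂ refl) = bound e
incident⇒close G {g} {e = e} bound (inj₂ refl) (inj₁ refl) =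
  ℕ.≤-trans (ℕ.≤-reflexive (ℤ.∣i-j∣≡∣j-i∣ (g (tgt G e)) (g (src G e)))) (bound e)

-- The right-hand side is (2 * t * b + t) ∸ 1, which is why t must be positive.
t[b+b]+[t∸1]≡2tb+t∸1 : ∀ {t} b → 1 ≤ t → t * (b + b) + (t ∸ 1) ≡ 2 * t * b + t ∸ 1
t[b+b]+[t∸1]≡2tb+t∸1 {t} b 1≤t = begin
  t * (b + b) + (t ∸ 1)   ≡⟨ cong (_+ (t ∸ 1)) (double t b) ⟩
  2 * t * b + (t ∸ 1)     ≡⟨ ℕ.+-∸-assoc (2 * t * b) 1≤t ⟨
  2 * t * b + t ∸ 1       ∎
  where
    open ≡-Reasoning
    double : ∀ t b → t * (b + b) ≡ 2 * t * b
    double = ℕ-Solver.solve-∀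

forestPartition⇒edgeNumbering : ∀ G {t g b} → ForestPartition G t → Injective _≡_ _≡_ g → VertexNumberingBound G g b →
  Σ (Fin (m G) → ℤ) λ f → Injective _≡_ _≡_ f × EdgeNumberingBound G f (2 * t * b + t ∸ 1)
forestPartition⇒edgeNumbering G {t} {g} {b} (colour , forest) g-inj g-bound = f , f-inj , f-bound
  where
    orientation : (i : Fin t) → Orientation G (λ e → colour e ≡ i)
    orientation i = forest⇒orientation (λ e → colour e Fin.≟ i) (forest i)

    head : Fin (m G) → Fin (n G)
    head e = Orientation.head (orientation (colour e)) e

    f : Fin (m G) → ℤ
    f e = + t ℤ.* g (head e) ℤ.+ + toℕ (colour e)

    f-inj : Injective _≡_ _≡_ f
    f-inj {e} {e'} eq with radix-injective t (Fin.toℕ<n (colour e)) (Fin.toℕ<n (colour e')) eq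
    ... | same-label , same-colour = Orientation.head-injective (orientation (colour e)) refl (sym c≡c') same-head
      where
        c≡c' : colour e ≡ colour e'
        c≡c' = Fin.toℕ-injective same-colour
        same-head : head e ≡ Orientation.head (orientation (colour e)) e'
        same-head = trans (g-inj same-label) (cong (λ i → Orientation.head (orientation i) e') (sym c≡c'))

    f-bound : EdgeNumberingBound G f (2 * t * b + t ∸ 1)
    f-bound e e' (_ , v , e∋v , e'∋v) = begin
      ∣ f e ℤ.- f e' ∣
        ≤⟨ radix-distance t _ _ _ _ ⟩
      t * ∣ g (head e) ℤ.- g (head e') ∣ + ∣ + toℕ (colour e) ℤ.- + toℕ (colour e') ∣
        ≤⟨ ℕ.+-mono-≤ (ℕ.*-monoʳ-≤ t heads-close) (∣i-j∣≤n∸1 (colour e) (colour e')) ⟩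
      t * (b + b) + (t ∸ 1)
        ≡⟨ t[b+b]+[t∸1]≡2tb+t∸1 b (ℕ.m<n⇒0<n (Fin.toℕ<n (colour e))) ⟩
      2 * t * b + t ∸ 1 ∎
      where
        open ℕ.≤-Reasoning
        head-incident : ∀ e → IncV G e (head e)
        head-incident e = Orientation.head-incident (orientation (colour e)) e
        heads-close : ∣ g (head e) ℤ.- g (head e') ∣ ≤ b + b
        heads-close = ℕ.≤-trans (∣i-k∣≤∣i-j∣+∣j-k∣ (g (head e)) (g v) (g (head e')))
          (ℕ.+-mono-≤ (incident⇒close G {g} g-bound (head-incident e) e∋v) (incident⇒close G {g} g-bound e'∋v (head-incident e')))

-- Stars

Walk : (G : Graph) → Fin (n G) → Fin (n G) → Set
Walk G u v = Σ ℕ λ k → Σ (Fin (suc k) → Fin (n G)) λ w →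
  w fzero ≡ u × w (fromℕ k) ≡ v × (∀ i j → toℕ j ≡ suc (toℕ i) → Adj G (w i) (w j))

walk₀ : ∀ G {u} → Walk G u u
walk₀ G {u} = 0 , (λ _ → u) , refl , refl , λ { fzero fzero () }

walk₁ : ∀ G {u v} → Adj G u v → Walk G u v
walk₁ G {u} {v} uv = 1 , w , refl , refl , steps
  where
    w : Fin 2 → Fin (n G)
    w fzero = u
    w (fsuc _) = v
    steps : ∀ i j → toℕ j ≡ suc (toℕ i) → Adj G (w i) (w j)
    steps fzero (fsuc fzero) _ = uv
    steps fzero fzero ()
    steps (fsuc fzero) fzero ()
    steps (fsuc fzero) (fsuc fzero) ()

walk₂ : ∀ G {u x v} → Adj G u x → Adj G x v → Walk G u v
walk₂ G {u} {x} {v} ux xv = 2 , w , refl , refl , steps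
  where
    w : Fin 3 → Fin (n G)
    w fzero = u
    w (fsuc fzero) = x
    w (fsuc (fsuc _)) = v
    steps : ∀ i j → toℕ j ≡ suc (toℕ i) → Adj G (w i) (w j)
    steps fzero (fsuc fzero) _ = ux
    steps (fsuc fzero) (fsuc (fsuc fzero)) _ = xv
    steps fzero fzero ()
    steps fzero (fsuc (fsuc fzero)) ()
    steps (fsuc fzero) fzero ()
    steps (fsuc fzero) (fsuc fzero) ()
    steps (fsuc (fsuc fzero)) fzero ()
    steps (fsuc (fsuc fzero)) (fsuc fzero) ()
    steps (fsuc (fsuc fzero)) (fsuc (fsuc fzero)) ()

cycle-edgeFromThirdVertex : ∀ {G P} l (c : Fin (3 + l) → Fin (n G)) →
  (∀ i j → toℕ j ≡ suc (toℕ i) → AdjIn G P (c i) (c j)) → AdjIn G P (c (fromℕ (2 + l))) (c fzero) →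
  Σ (Fin (3 + l)) λ j → j ≢ fsuc fzero × AdjIn G P (c (fsuc (fsuc fzero))) (c j)
cycle-edgeFromThirdVertex zero c steps closing = fzero , (λ ()) , closing
cycle-edgeFromThirdVertex (suc l) c steps closing =
  fsuc (fsuc (fsuc fzero)) , (λ ()) , steps (fsuc (fsuc fzero)) (fsuc (fsuc (fsuc fzero))) refl

star : ℕ → Graph
star k = record
  { n = suc k ; m = k ; src = λ _ → fzero ; tgt = fsuc
  ; loopless = λ _ ()
  ; simple = λ { _ _ (inj₁ (_ , same-leaf)) → Fin.suc-injective same-leaf ; _ _ (inj₂ (() , _)) }
  }

star-acyclic : ∀ k (P : Fin k → Set) → IsForest (star k) P
-- Every edge meets the centre: as c₀c₁ and c₁c₂ share only c₁, the centre is c₁, and then the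
-- edge of the cycle leaving c₂ away from c₁ misses it.
star-acyclic k P (l , c , c-inj , steps , closing) with cycle-edgeFromThirdVertex {star k} {P} l c steps closing
... | j , j≢1 , c₂cⱼ = [ centre≢c₀ , centre≢c₁ ]′ (meets-centre (steps fzero (fsuc fzero) refl))
  where
    meets-centre : ∀ {u v} → AdjIn (star k) P u v → u ≡ fzero ⊎ v ≡ fzero
    meets-centre (_ , _ , inj₁ (u≡z , _)) = inj₁ (sym u≡z)
    meets-centre (_ , _ , inj₂ (v≡z , _)) = inj₂ (sym v≡z)
    distinct : ∀ {i j} → c i ≡ fzero → c j ≡ fzero → i ≢ j → ⊥
    distinct cᵢ≡z cⱼ≡z i≢j = i≢j (c-inj (trans cᵢ≡z (sym cⱼ≡z)))
    centre≢c₀ : c fzero ≡ fzero → ⊥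
    centre≢c₀ c₀≡z = [ (λ c₁≡z → distinct c₀≡z c₁≡z λ ()) , (λ c₂≡z → distinct c₀≡z c₂≡z λ ()) ]′
                       (meets-centre (steps (fsuc fzero) (fsuc (fsuc fzero)) refl))
    centre≢c₁ : c (fsuc fzero) ≡ fzero → ⊥
    centre≢c₁ c₁≡z = [ (λ c₂≡z → distinct c₂≡z c₁≡z λ ()) , (λ cⱼ≡z → distinct cⱼ≡z c₁≡z j≢1) ]′ (meets-centre c₂cⱼ)

star-connected : ∀ k → Connected (star k)
star-connected k fzero fzero = walk₀ (star k)
star-connected k fzero (fsuc e) = walk₁ (star k) (e , inj₁ (refl , refl))
star-connected k (fsuc e) fzero = walk₁ (star k) (e , inj₂ (refl , refl))
star-connected k (fsuc e) (fsuc e') = walk₂ (star k) (e , inj₂ (refl , refl)) (e' , inj₁ (refl , refl))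

star-leaf : ∀ k (e : Fin k) → IsLeaf (star k) (fsuc e)
star-leaf k e = e , inj₂ refl , λ { _ (inj₁ ()) ; _ (inj₂ same-leaf) → Fin.suc-injective same-leaf }

star-centre-not-leaf : ∀ {k} → 2 ≤ k → ¬ IsLeaf (star k) fzero
star-centre-not-leaf {suc (suc k)} (s≤s (s≤s z≤n)) (_ , _ , only) =
  case trans (only fzero (inj₁ refl)) (sym (only (fsuc fzero) (inj₁ refl))) of λ ()

star-isCaterpillar : ∀ k → 2 ≤ k → IsCaterpillar (star k)
star-isCaterpillar k 2≤k = (s≤s z≤n , star-connected k , star-acyclic k _) , spine
  where
    only-centre : ∀ v → ¬ IsLeaf (star k) v → Σ (Fin 1) λ _ → fzero ≡ v
    only-centre fzero _ = fzero , refl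
    only-centre (fsuc e) not-leaf = ⊥-elim (not-leaf (star-leaf k e))
    adjacency : ∀ (i j : Fin 1) → (Adj (star k) fzero fzero → Consecutive i j) × (Consecutive i j → Adj (star k) fzero fzero)
    adjacency fzero fzero = (λ (_ , joins) → ⊥-elim (joins⇒≢ (star k) joins refl)) , λ { (inj₁ ()) ; (inj₂ ()) }
    spine : LeafDeletedIsPath (star k)
    spine = 1 , (λ _ → fzero) , (λ { {fzero} {fzero} _ → refl }) , (λ _ → star-centre-not-leaf 2≤k) , only-centre , adjacency

star-bandwidth : ∀ B → IsBandwidth (star (2 * B)) B
star-bandwidth B = (g , g-inj , g-bound) , lower
  where
    G = star (2 * B)
    B+B≡2B : B + B ≡ 2 * B
    B+B≡2B = cong (λ x → B + x) (sym (ℕ.+-identityʳ B))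

    middle : Fin (suc (2 * B))
    middle = fromℕ< (s≤s (ℕ.m≤m+n B (B + 0)))
    position : Fin (suc (2 * B)) → Fin (suc (2 * B))
    position fzero = middle
    position (fsuc e) = punchIn middle e
    position-inj : Injective _≡_ _≡_ position
    position-inj {fzero} {fzero} _ = refl
    position-inj {fzero} {fsuc e} eq = ⊥-elim (Fin.punchInᵢ≢i middle e (sym eq))
    position-inj {fsuc e} {fzero} eq = ⊥-elim (Fin.punchInᵢ≢i middle e eq)
    position-inj {fsuc e} {fsuc e'} eq = cong fsuc (Fin.punchIn-injective middle e e' eq)

    g : Fin (n G) → ℤ
    g v = + toℕ (position v)
    g-inj : Injective _≡_ _≡_ g
    g-inj = position-inj ∘ Fin.toℕ-injective ∘ ℤ.+-injective
    g-bound : VertexNumberingBound G g B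
    g-bound e = begin
      ∣ + toℕ middle ℤ.- + x ∣   ≡⟨ cong (λ y → ∣ + y ℤ.- + x ∣) (Fin.toℕ-fromℕ< _) ⟩
      ∣ + B ℤ.- + x ∣            ≡⟨ cong ∣_∣ (ℤ.[+m]-[+n]≡m⊖n B x) ⟩
      ∣ B ⊖ x ∣                  ≤⟨ ∣m⊖n∣≤o (ℕ.m≤n+m B x) (ℕ.≤-trans (Fin.toℕ≤pred[n] (punchIn middle e)) (ℕ.≤-reflexive (sym B+B≡2B))) ⟩
      B                          ∎
      where
        open ℕ.≤-Reasoning
        x = toℕ (punchIn middle e)

    lower : ∀ g' → Injective _≡_ _≡_ g' → ∀ k → VertexNumberingBound G g' k → B ≤ k
    lower g' g'-inj k bound = ℕ.*-cancelˡ-≤ 2 (ℕ.≤-pred (injective∧spread≤s⇒n≤1+s g' g'-inj spread))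
      where
        near-centre : ∀ v → ∣ g' fzero ℤ.- g' v ∣ ≤ k
        near-centre fzero = ∣i-i∣≤n (g' fzero)
        near-centre (fsuc e) = bound e
        spread : ∀ u v → ∣ g' u ℤ.- g' v ∣ ≤ 2 * k
        spread u v = begin
          ∣ g' u ℤ.- g' v ∣                              ≤⟨ ∣i-k∣≤∣i-j∣+∣j-k∣ (g' u) (g' fzero) (g' v) ⟩
          ∣ g' u ℤ.- g' fzero ∣ + ∣ g' fzero ℤ.- g' v ∣  ≡⟨ cong (_+ ∣ g' fzero ℤ.- g' v ∣) (ℤ.∣i-j∣≡∣j-i∣ (g' u) (g' fzero)) ⟩
          ∣ g' fzero ℤ.- g' u ∣ + ∣ g' fzero ℤ.- g' v ∣  ≤⟨ ℕ.+-mono-≤ (near-centre u) (near-centre v) ⟩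
          k + k                                          ≡⟨ cong (λ x → k + x) (ℕ.+-identityʳ k) ⟨
          2 * k                                          ∎
          where open ℕ.≤-Reasoning

star-edgeBandwidth : ∀ k → IsEdgeBandwidth (star k) (k ∸ 1)
star-edgeBandwidth k = ((λ e → + toℕ e) , Fin.toℕ-injective ∘ ℤ.+-injective , λ e e' _ → ∣i-j∣≤n∸1 e e') , lower
  where
    lower : ∀ f → Injective _≡_ _≡_ f → ∀ k' → EdgeNumberingBound (star k) f k' → k ∸ 1 ≤ k'
    lower f f-inj k' bound = ℕ.m≤n+o⇒m∸n≤o k 1 (injective∧spread≤s⇒n≤1+s f f-inj spread)
      where
        spread : ∀ e e' → ∣ f e ℤ.- f e' ∣ ≤ k'
        spread e e' with e Fin.≟ e'
        ... | yes refl = ∣i-i∣≤n (f e)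
        ... | no e≢e' = bound e e' (e≢e' , fzero , inj₁ refl , inj₁ refl)

theorem9 : ((G : Graph) (t b b' : ℕ) → IsArboricity G t → IsBandwidth G b → IsEdgeBandwidth G b' → b' ≤ 2 * t * b + t ∸ 1)
    × ((b : ℕ) → 1 ≤ b → Σ Graph λ G → IsCaterpillar G × IsBandwidth G b × IsEdgeBandwidth G (2 * b ∸ 1))
theorem9 = upper-bound , sharpness
  where
    upper-bound : (G : Graph) (t b b' : ℕ) → IsArboricity G t → IsBandwidth G b → IsEdgeBandwidth G b' → b' ≤ 2 * t * b + t ∸ 1
    upper-bound G t b b' (partition , _) ((g , g-inj , g-bound) , _) (_ , b'-minimal) =
      let f , f-inj , f-bound = forestPartition⇒edgeNumbering G partition g-inj g-bound
      in b'-minimal f f-inj _ f-bound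
    sharpness : (b : ℕ) → 1 ≤ b → Σ Graph λ G → IsCaterpillar G × IsBandwidth G b × IsEdgeBandwidth G (2 * b ∸ 1)
    sharpness b 1≤b = star (2 * b) , star-isCaterpillar (2 * b) (ℕ.*-monoʳ-≤ 2 1≤b) , star-bandwidth b , star-edgeBandwidth (2 * b)
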